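{- For all integers $n \geq 2$, \[ P(n) \geq f(n) + \min\Big\{Q(g(n)),\ \sqrt{2(g(n)+f(n)+1)} + 3/2,\ f(n) - 2\Big\} \] and \[ Q(n) \geq 1 + f(n) + \min\Big\{P(g(n)),\ \sqrt{2(g(n)+f(n)+1)} + 1/2\Big\}. \]
   Context: For $A \subseteq \{0,1,2,\ldots\}$, $\partial A = \{z \in A : \{z-1,z+1\} \not\subseteq A\}$, $vol(A)=\sum_{z\in A} z$, $per(A) = \sum_{z \in \partial A} z$ (both $0$ for the empty set), and $A^c = \{0,1,2,\ldots\}\setminus A$. For integers $n\ge 0$, $P(n) = \min\{per(A) : A \subseteq \{0,1,\ldots\},\ vol(A)=n\}$ and $Q(n) = \min\{per(A^c) : A \subseteq \{0,1,\ldots\},\ vol(A) = n\}$. Also $f(n) = \lceil (-1+\sqrt{1+8n})/2 \rceil$ and $g(n) = f(n)(f(n)+1)/2 - n$. -}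

module Defs where

open import Data.Nat using (ℕ; zero; suc; _+_; _*_; _∸_; _≤_; _<_; _≤ᵇ_; _≡ᵇ_)
open import Data.Bool using (Bool; true; false; if_then_else_; _∧_; _∨_; not)
open import Data.Product using (Σ; _×_; ∃)
open import Relation.Binary.PropositionalEquality using (_≡_)

-- A finite subset of {0,1,2,...}, given by a decidable membership predicate
-- together with a bound beyond which nothing is a member.
-- (Every A ⊆ ℕ with finite volume vol(A) is of this form.)
record FinSet : Set where
  field
    mem     : ℕ → Bool
    bound   : ℕ
    outside : ∀ z → bound < z → mem z ≡ false
open FinSet public

sumBelow : ℕ → (ℕ → ℕ) → ℕ
sumBelow zero    h = 0
sumBelow (suc N) h = sumBelow N h + h N

vol : FinSet → ℕ
vol A = sumBelow (suc (bound A)) (λ z → if mem A z then z else 0)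

-- z ∈ ∂A  iff  z ∈ A and {z-1, z+1} ⊄ A   (for z = 0, z-1 = -1 ∉ A)
inBd : (ℕ → Bool) → ℕ → Bool
inBd S z = S z ∧ ((z ≡ᵇ 0) ∨ not (S (z ∸ 1)) ∨ not (S (suc z)))

per : FinSet → ℕ
per A = sumBelow (suc (bound A)) (λ z → if inBd (mem A) z then z else 0)

-- per(A^c) = Σ_{z ∈ ∂(A^c)} z ; ∂(A^c) ⊆ {0..bound+1}
perC : FinSet → ℕ
perC A = sumBelow (suc (suc (bound A)))
           (λ z → if inBd (λ w → not (mem A w)) z then z else 0)

-- "P(n) = m":  m is the minimum of per(A) over A with vol(A) = n
IsP : ℕ → ℕ → Set
IsP n m = (Σ FinSet λ A → vol A ≡ n × per A ≡ m)
        × (∀ (A : FinSet) → vol A ≡ n → m ≤ per A)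

-- "Q(n) = m":  m is the minimum of per(A^c) over A with vol(A) = n
IsQ : ℕ → ℕ → Set
IsQ n m = (Σ FinSet λ A → vol A ≡ n × perC A ≡ m)
        × (∀ (A : FinSet) → vol A ≡ n → m ≤ perC A)

tri : ℕ → ℕ
tri zero    = 0
tri (suc k) = tri k + suc k

fFrom : ℕ → ℕ → ℕ → ℕ
fFrom zero       k n = k
fFrom (suc fuel) k n = if n ≤ᵇ tri k then k else fFrom fuel (suc k) n

-- f(n) = ⌈(-1+√(1+8n))/2⌉ = least k with n ≤ k(k+1)/2  (tri n ≥ n, so fuel n suffices)
f : ℕ → ℕ
f n = fFrom n 0 n

g : ℕ → ℕ
g n = tri (f n) ∸ n

-- "√s + h/2 ≤ y" for natural s, h, y  (equivalently: h ≤ 2y and 4s ≤ (2y - h)^2)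
SqrtHalfLe : ℕ → ℕ → ℕ → Set
SqrtHalfLe s h y = h ≤ 2 * y × 4 * s ≤ (2 * y ∸ h) * (2 * y ∸ h)

module Submission where

-- Take A optimal for P(n) or Q(n), with largest element b.  As k is the least
-- index with n ≤ T(k) and n = vol A ≤ T(b), k ≤ b; the holes below b weigh
-- T(b) - n.
--  * b = k.  B = {0..k} \ A has volume T(k) - n = g, and A and the complement
--    of B agree on {0..k}; comparing the boundary sums term by term gives
--    per A = per(Bᶜ) + k (if k-1 ∈ A) and per(Aᶜ) = (k+1) + per B.
--  * b > k.  Then A has holes below b; let d be the last one.  All hole
--    weight is at most T(d), while d+1, b ∈ ∂A and d, b+1 ∈ ∂(Aᶜ), so per A and
--    per(Aᶜ) are at least d+1+b.  As g+k+1 = T(k+1) - n ≤ T(b) - n ≤ T(d) and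
--    √(d(d+1)) ≤ d + 1/2, this is the square-root alternative.
--  * b-1 ∉ A (relevant for P only).  With b' the next element of A below b
--    (or b' = 0) we get b' + b ≤ per A and n ≤ T(b') + b, forcing 2k ≤ per A + 2.
-- The file develops finite sums, boundaries, triangular numbers and f, then
-- the structure of a finite set around its top element, then the cases.

open import Defs
open import Data.Bool using (Bool; true; false; if_then_else_; _∧_; _∨_; not)
open import Data.Bool.Properties using (∨-zeroʳ; not-involutive)
open import Data.Empty using (⊥; ⊥-elim)
open import Data.Nat
  using (ℕ; zero; suc; _+_; _*_; _∸_; _≤_; _<_; _≤′_; _≤ᵇ_; _≡ᵇ_; _≤?_; z≤n; s≤s; ≤′-refl; ≤′-step)
open import Data.Nat.Properties
open import Data.Nat.Tactic.RingSolver using (solve-∀)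
open import Data.Product using (Σ; _×_; _,_; proj₁)
open import Data.Sum using (_⊎_; inj₁; inj₂)
open import Relation.Nullary using (yes; no)
open import Relation.Nullary.Reflects using (ofʸ; ofⁿ)
open import Relation.Binary.PropositionalEquality

conflict : ∀ {x} → x ≡ true → x ≡ false → ⊥
conflict refl ()

not-flip : ∀ {x y} → not x ≡ y → x ≡ not y
not-flip {x} e = trans (sym (not-involutive x)) (cong not e)

≤ᵇ-true : ∀ {m n} → m ≤ n → (m ≤ᵇ n) ≡ true
≤ᵇ-true {m} {n} m≤n with m ≤ᵇ n | ≤ᵇ-reflects-≤ m n
... | true  | _       = refl
... | false | ofⁿ m≰n = ⊥-elim (m≰n m≤n)

≤ᵇ-false : ∀ {m n} → n < m → (m ≤ᵇ n) ≡ false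
≤ᵇ-false {m} {n} n<m with m ≤ᵇ n | ≤ᵇ-reflects-≤ m n
... | false | _       = refl
... | true  | ofʸ m≤n = ⊥-elim (<⇒≱ n<m m≤n)

inW : (ℕ → Bool) → ℕ → ℕ
inW S z = if S z then z else 0

inW-true : ∀ S z → S z ≡ true → inW S z ≡ z
inW-true S z e = cong (λ c → if c then z else 0) e

inW-false : ∀ S z → S z ≡ false → inW S z ≡ 0
inW-false S z e = cong (λ c → if c then z else 0) e

inW≤ : ∀ S z → inW S z ≤ z
inW≤ S z with S z
... | true  = ≤-refl
... | false = z≤n

inW-split : ∀ S z → inW S z + inW (λ w → not (S w)) z ≡ z
inW-split S z with S z
... | true  = +-identityʳ z
... | false = refl

sum-cong : ∀ N {h h′ : ℕ → ℕ} → (∀ z → z < N → h z ≡ h′ z) → sumBelow N h ≡ sumBelow N h′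
sum-cong zero    _ = refl
sum-cong (suc N) e = cong₂ _+_ (sum-cong N (λ z z<N → e z (m<n⇒m<1+n z<N))) (e N (n<1+n N))

sum-mono : ∀ N {h h′ : ℕ → ℕ} → (∀ z → z < N → h z ≤ h′ z) → sumBelow N h ≤ sumBelow N h′
sum-mono zero    _ = z≤n
sum-mono (suc N) e = +-mono-≤ (sum-mono N (λ z z<N → e z (m<n⇒m<1+n z<N))) (e N (n<1+n N))

sum-+ : ∀ N (h h′ : ℕ → ℕ) → sumBelow N h + sumBelow N h′ ≡ sumBelow N (λ z → h z + h′ z)
sum-+ zero    h h′ = refl
sum-+ (suc N) h h′ = trans (interchange (sumBelow N h) (h N) (sumBelow N h′) (h′ N))
                           (cong (_+ (h N + h′ N)) (sum-+ N h h′))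
  where
  interchange : ∀ a b c d → (a + b) + (c + d) ≡ (a + c) + (b + d)
  interchange = solve-∀

sum-prefix : ∀ {N M} (h : ℕ → ℕ) → N ≤ M → sumBelow N h ≤ sumBelow M h
sum-prefix h N≤M = go (≤⇒≤′ N≤M)
  where
  go : ∀ {N M} → N ≤′ M → sumBelow N h ≤ sumBelow M h
  go ≤′-refl      = ≤-refl
  go (≤′-step le) = ≤-trans (go le) (m≤m+n _ _)

sum-trunc : ∀ {N M} {h : ℕ → ℕ} → N ≤ M → (∀ z → N ≤ z → z < M → h z ≡ 0) →
            sumBelow M h ≡ sumBelow N h
sum-trunc {h = h} N≤M = go (≤⇒≤′ N≤M)
  where
  go : ∀ {N M} → N ≤′ M → (∀ z → N ≤ z → z < M → h z ≡ 0) → sumBelow M h ≡ sumBelow N h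
  go ≤′-refl                 _      = refl
  go {M = suc M} (≤′-step le) vanish = begin
    sumBelow M h + h M  ≡⟨ cong (sumBelow M h +_) (vanish M (≤′⇒≤ le) (n<1+n M)) ⟩
    sumBelow M h + 0    ≡⟨ +-identityʳ _ ⟩
    sumBelow M h        ≡⟨ go le (λ z N≤z z<M → vanish z N≤z (m<n⇒m<1+n z<M)) ⟩
    _                   ∎
    where open ≡-Reasoning

term≤sum : ∀ {x N} (h : ℕ → ℕ) → x < N → h x ≤ sumBelow N h
term≤sum {x} h x<N = ≤-trans (m≤n+m (h x) (sumBelow x h)) (sum-prefix h x<N)

twoTerms≤sum : ∀ {x y N} (h : ℕ → ℕ) → x < y → y < N → h x + h y ≤ sumBelow N h
twoTerms≤sum {y = y} h x<y y<N =
  ≤-trans (+-monoˡ-≤ (h y) (term≤sum h x<y)) (sum-prefix h y<N)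

sum-id : ∀ b → sumBelow (suc b) (λ z → z) ≡ tri b
sum-id zero    = refl
sum-id (suc b) = cong (_+ suc b) (sum-id b)

sumInW≤tri : ∀ S d → sumBelow (suc d) (inW S) ≤ tri d
sumInW≤tri S d = ≤-trans (sum-mono (suc d) (λ z _ → inW≤ S z)) (≤-reflexive (sum-id d))

bdSum : (ℕ → Bool) → ℕ → ℕ
bdSum S N = sumBelow N (inW (inBd S))

∉⇒∉∂ : ∀ S z → S z ≡ false → inBd S z ≡ false
∉⇒∉∂ S z e = cong (λ c → c ∧ ((z ≡ᵇ 0) ∨ not (S (z ∸ 1)) ∨ not (S (suc z)))) e

right∈∂ : ∀ S z → S z ≡ true → S (suc z) ≡ false → inBd S z ≡ true
right∈∂ S z Sz Sz+1 rewrite Sz | Sz+1 =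
  trans (cong ((z ≡ᵇ 0) ∨_) (∨-zeroʳ (not (S (z ∸ 1))))) (∨-zeroʳ (z ≡ᵇ 0))

left∈∂ : ∀ S z → S z ≡ true → S (z ∸ 1) ≡ false → inBd S z ≡ true
left∈∂ S z Sz Sz-1 rewrite Sz | Sz-1 = ∨-zeroʳ (z ≡ᵇ 0)

interior∉∂ : ∀ S z → S z ≡ true → S (suc z) ≡ true → S (suc (suc z)) ≡ true → inBd S (suc z) ≡ false
interior∉∂ S z Sz Sz+1 Sz+2 rewrite Sz | Sz+1 | Sz+2 = refl

-- Being a boundary point only depends on the point and its two neighbours.
bdSum-local : ∀ {S S′} N → (∀ w → w ≤ N → S w ≡ S′ w) → bdSum S N ≡ bdSum S′ N
bdSum-local {S} {S′} N agree = sum-cong N (λ z z<N → cong (λ c → if c then z else 0) (local z z<N))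
  where
  local : ∀ z → z < N → inBd S z ≡ inBd S′ z
  local z z<N = cong₂ _∧_ (agree z (<⇒≤ z<N))
    (cong₂ _∨_ (refl {x = z ≡ᵇ 0})
      (cong₂ _∨_ (cong not (agree (z ∸ 1) (≤-trans (m∸n≤m z 1) (<⇒≤ z<N))))
                 (cong not (agree (suc z) z<N))))

bd≤ : ∀ S {x N} → x < N → inBd S x ≡ true → x ≤ bdSum S N
bd≤ S {x} {N} x<N x∈∂ =
  subst (_≤ bdSum S N) (inW-true (inBd S) x x∈∂) (term≤sum (inW (inBd S)) x<N)

bdPair≤ : ∀ S {x y N} → x < y → y < N → inBd S x ≡ true → inBd S y ≡ true → x + y ≤ bdSum S N
bdPair≤ S {x} {y} {N} x<y y<N x∈∂ y∈∂ =
  subst (_≤ bdSum S N) (cong₂ _+_ (inW-true (inBd S) x x∈∂) (inW-true (inBd S) y y∈∂))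
        (twoTerms≤sum (inW (inBd S)) x<y y<N)

-- T is monotone, as a prefix sum of 0, 1, 2, ...
tri-mono : ∀ {j l} → j ≤ l → tri j ≤ tri l
tri-mono {j} {l} j≤l = subst₂ _≤_ (sum-id j) (sum-id l) (sum-prefix (λ z → z) (s≤s j≤l))

tri-double : ∀ d → 2 * tri d ≡ d * suc d
tri-double zero    = refl
tri-double (suc d) = begin
  2 * (tri d + suc d)      ≡⟨ *-distribˡ-+ 2 (tri d) (suc d) ⟩
  2 * tri d + 2 * suc d    ≡⟨ cong (_+ 2 * suc d) (tri-double d) ⟩
  d * suc d + 2 * suc d    ≡⟨ step d ⟩
  suc d * suc (suc d)      ∎
  where
  open ≡-Reasoning
  step : ∀ d → d * suc d + 2 * suc d ≡ suc d * suc (suc d)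
  step = solve-∀

-- n ≤ T(n), so n steps of search suffice in the definition of f.
n≤tri : ∀ n → n ≤ tri n
n≤tri zero    = z≤n
n≤tri (suc n) = m≤n+m (suc n) (tri n)

LeastTri : ℕ → ℕ → Set
LeastTri n k = n ≤ tri k × (∀ j → j < k → tri j < n)

fFrom-least : ∀ fuel k n → (∀ j → j < k → tri j < n) → n ≤ tri (k + fuel) →
              LeastTri n (fFrom fuel k n)
fFrom-least zero k n below n≤ = subst (λ t → n ≤ tri t) (+-identityʳ k) n≤ , below
fFrom-least (suc fuel) k n below n≤ with n ≤ᵇ tri k | ≤ᵇ-reflects-≤ n (tri k)
... | true  | ofʸ n≤Tk = n≤Tk , below
... | false | ofⁿ n≰Tk =
  fFrom-least fuel (suc k) n below′ (subst (λ t → n ≤ tri t) (+-suc k fuel) n≤)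
  where
  below′ : ∀ j → j < suc k → tri j < n
  below′ j j<k+1 with m<1+n⇒m<n∨m≡n j<k+1
  ... | inj₁ j<k  = below j j<k
  ... | inj₂ refl = ≰⇒> n≰Tk

f-least : ∀ n → LeastTri n (f n)
f-least n = fFrom-least n 0 n (λ _ ()) (n≤tri n)

least≤ : ∀ {n k b} → LeastTri n k → n ≤ tri b → k ≤ b
least≤ (_ , below) n≤Tb = ≮⇒≥ (λ b<k → <⇒≱ (below _ b<k) n≤Tb)

least-pos : ∀ {n k} → 1 ≤ n → LeastTri n k → 1 ≤ k
least-pos {k = zero}  (s≤s _) (() , _)
least-pos {k = suc k} _       _        = s≤s z≤n

-- If T(k-1) < n ≤ T(b') + b and k ≥ b' + 3, then b > T(k-1) - T(b') ≥ (k-1) + (k-2),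
-- i.e. 2k ≤ b + 2.
farTop : ∀ {n k b′ b} → (∀ j → j < k → tri j < n) → n ≤ tri b′ + b → 3 + b′ ≤ k → k + k ≤ b + 2
farTop {n} {suc (suc (suc j))} {b′} {b} below n≤ (s≤s (s≤s (s≤s b′≤j))) = begin
  suc (suc (suc j)) + suc (suc (suc j)) ≡⟨ regroup j ⟩
  suc (suc j + suc (suc j)) + 2         ≤⟨ +-monoˡ-≤ 2 (+-cancelˡ-< (tri j) _ _ heavy) ⟩
  b + 2                                 ∎
  where
  open ≤-Reasoning
  regroup : ∀ j → suc (suc (suc j)) + suc (suc (suc j)) ≡ suc (suc j + suc (suc j)) + 2
  regroup = solve-∀
  heavy : tri j + (suc j + suc (suc j)) < tri j + b
  heavy = begin-strict
    tri j + (suc j + suc (suc j)) ≡⟨ sym (+-assoc (tri j) _ _) ⟩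
    tri (suc (suc j))             <⟨ below (suc (suc j)) (n<1+n _) ⟩
    n                             ≤⟨ n≤ ⟩
    tri b′ + b                    ≤⟨ +-monoˡ-≤ b (tri-mono b′≤j) ⟩
    tri j + b                     ∎

-- If n ≤ T(b') + b and k ≤ b, then 2k ≤ b' + b + 2: either k ≤ b' + 2,
-- or farTop applies.  (Used with b' < b the two largest elements of A.)
isolatedBound : ∀ {n k b′ b} → LeastTri n k → n ≤ tri b′ + b → k ≤ b → k + k ≤ b′ + b + 2
isolatedBound {k = k} {b′} {b} (_ , below) n≤ k≤b with k ≤? 2 + b′
... | yes k≤2+b′ = begin
  k + k        ≤⟨ +-mono-≤ k≤2+b′ k≤b ⟩
  2 + b′ + b   ≡⟨ +-comm 2 (b′ + b) ⟩
  b′ + b + 2   ∎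
  where open ≤-Reasoning
... | no k≰2+b′ = ≤-trans (farTop below n≤ (≰⇒> k≰2+b′)) (+-monoˡ-≤ 2 (m≤n+m b b′))

-- √s + h/2 ≤ y follows from s ≤ d(d+1) and d + 1/2 + h/2 ≤ y,
-- because 4d(d+1) < (2d+1)².
sqrtHalfLe-intro : ∀ {s h y} d → s ≤ d * suc d → 2 * d + 1 + h ≤ 2 * y → SqrtHalfLe s h y
sqrtHalfLe-intro {s} {h} {y} d s≤ offset = ≤-trans (m≤n+m h (2 * d + 1)) offset , square
  where
  open ≤-Reasoning
  root : 2 * d + 1 ≤ 2 * y ∸ h
  root = m+n≤o⇒m≤o∸n (2 * d + 1) offset
  odd² : ∀ d → 4 * (d * suc d) + 1 ≡ (2 * d + 1) * (2 * d + 1)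
  odd² = solve-∀
  square : 4 * s ≤ (2 * y ∸ h) * (2 * y ∸ h)
  square = begin
    4 * s                       ≤⟨ *-monoʳ-≤ 4 s≤ ⟩
    4 * (d * suc d)             ≤⟨ m≤m+n _ 1 ⟩
    4 * (d * suc d) + 1         ≡⟨ odd² d ⟩
    (2 * d + 1) * (2 * d + 1)   ≤⟨ *-mono-≤ root root ⟩
    (2 * y ∸ h) * (2 * y ∸ h)   ∎

-- If n ≤ T(k) < T(b) = n + H, the hole weight H
-- is at most T(d) and X ≥ (d+1) + b, then √(2(g+k+1)) + (2k+3)/2 ≤ X with
-- g = T(k) - n: indeed g + k + 1 = T(k+1) - n ≤ H ≤ T(d).
sqrtAlternative : ∀ {n k b d H X} → n ≤ tri k → k < b → n + H ≡ tri b → H ≤ tri d → suc d + b ≤ X →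
                  SqrtHalfLe (2 * ((tri k ∸ n) + k + 1)) (2 * k + 3) X
sqrtAlternative {n} {k} {b} {d} {H} {X} n≤Tk k<b n+H≡Tb H≤Td d+b≤X =
  sqrtHalfLe-intro {y = X} d radicand offset
  where
  open ≤-Reasoning
  g′ : ℕ
  g′ = tri k ∸ n
  rearrange : ∀ a k n → (a + k + 1) + n ≡ (a + n) + suc k
  rearrange = solve-∀
  excess : g′ + k + 1 ≤ H
  excess = +-cancelʳ-≤ n (g′ + k + 1) H (begin
    (g′ + k + 1) + n   ≡⟨ rearrange g′ k n ⟩
    (g′ + n) + suc k   ≡⟨ cong (_+ suc k) (m∸n+n≡m n≤Tk) ⟩
    tri (suc k)        ≤⟨ tri-mono k<b ⟩
    tri b              ≡⟨ sym n+H≡Tb ⟩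
    n + H              ≡⟨ +-comm n H ⟩
    H + n              ∎)
  radicand : 2 * (g′ + k + 1) ≤ d * suc d
  radicand = begin
    2 * (g′ + k + 1)   ≤⟨ *-monoʳ-≤ 2 (≤-trans excess H≤Td) ⟩
    2 * tri d          ≡⟨ tri-double d ⟩
    d * suc d          ∎
  doubled : ∀ d k → 2 * d + 1 + (2 * k + 3) ≡ 2 * (suc d + suc k)
  doubled = solve-∀
  offset : 2 * d + 1 + (2 * k + 3) ≤ 2 * X
  offset = begin
    2 * d + 1 + (2 * k + 3)   ≡⟨ doubled d k ⟩
    2 * (suc d + suc k)       ≤⟨ *-monoʳ-≤ 2 (+-monoʳ-≤ (suc d) k<b) ⟩
    2 * (suc d + b)           ≤⟨ *-monoʳ-≤ 2 d+b≤X ⟩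
    2 * X                     ∎

LastBelow : (ℕ → Bool) → ℕ → ℕ → Set
LastBelow S b d = d < b × S d ≡ true × (∀ z → d < z → z < b → S z ≡ false)

lastBelow : ∀ S b → Σ ℕ (LastBelow S b) ⊎ (∀ z → z < b → S z ≡ false)
lastBelow S zero = inj₂ (λ _ ())
lastBelow S (suc b) with S b in Sb
... | true  = inj₁ (b , n<1+n b , Sb , λ z b<z z<b+1 → ⊥-elim (<⇒≱ b<z (≤-pred z<b+1)))
... | false = extend (lastBelow S b)
  where
  stillFalse : ∀ z → z < suc b → (z < b → S z ≡ false) → S z ≡ false
  stillFalse z z<b+1 belowB with m<1+n⇒m<n∨m≡n z<b+1
  ... | inj₁ z<b  = belowB z<b
  ... | inj₂ refl = Sb
  extend : Σ ℕ (LastBelow S b) ⊎ (∀ z → z < b → S z ≡ false) →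
           Σ ℕ (LastBelow S (suc b)) ⊎ (∀ z → z < suc b → S z ≡ false)
  extend (inj₁ (d , d<b , Sd , after)) =
    inj₁ (d , m<n⇒m<1+n d<b , Sd , λ z d<z z<b+1 → stillFalse z z<b+1 (after z d<z))
  extend (inj₂ none) = inj₂ (λ z z<b+1 → stillFalse z z<b+1 (none z))

record Top (A : FinSet) (b : ℕ) : Set where
  constructor isTop
  field
    top∈   : mem A b ≡ true
    above∉ : ∀ z → b < z → mem A z ≡ false

notIn : FinSet → ℕ → Bool
notIn A w = not (mem A w)

holes : FinSet → ℕ → ℕ
holes A b = sumBelow (suc b) (inW (notIn A))

top≤bound : ∀ {A b} → Top A b → b ≤ bound A
top≤bound {A} {b} (isTop A∋b _) = ≮⇒≥ (λ bound<b → conflict A∋b (outside A b bound<b))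

top-exists : ∀ A → 0 < vol A → Σ ℕ (Top A)
top-exists A vol>0 with lastBelow (mem A) (suc (bound A))
... | inj₁ (b , _ , A∋b , after) = b , isTop A∋b aboveB
  where
  aboveB : ∀ z → b < z → mem A z ≡ false
  aboveB z b<z with z ≤? bound A
  ... | yes z≤bound = after z b<z (s≤s z≤bound)
  ... | no  z≰bound = outside A z (≰⇒> z≰bound)
... | inj₂ empty = ⊥-elim (<-irrefl (sym volIs0) vol>0)
  where
  volIs0 : vol A ≡ 0
  volIs0 = sum-trunc z≤n (λ z _ z<N → inW-false (mem A) z (empty z z<N))

vol-top : ∀ {A b} → Top A b → vol A ≡ sumBelow (suc b) (inW (mem A))
vol-top {A} top@(isTop _ aboveB) =
  sum-trunc (s≤s (top≤bound top)) (λ z b<z _ → inW-false (mem A) z (aboveB z b<z))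

per-top : ∀ {A b} → Top A b → per A ≡ bdSum (mem A) (suc b)
per-top {A} top@(isTop _ aboveB) =
  sum-trunc (s≤s (top≤bound top))
            (λ z b<z _ → inW-false (inBd (mem A)) z (∉⇒∉∂ (mem A) z (aboveB z b<z)))

perC-top : ∀ {A b} → Top A b → perC A ≡ bdSum (notIn A) (suc (suc b))
perC-top {A} {b} top@(isTop _ aboveB) = sum-trunc (s≤s (s≤s (top≤bound top))) vanish
  where
  Aᶜ∋ : ∀ w → b < w → notIn A w ≡ true
  Aᶜ∋ w b<w = cong not (aboveB w b<w)
  vanish : ∀ z → suc (suc b) ≤ z → z < suc (suc (bound A)) → inW (inBd (notIn A)) z ≡ 0
  vanish (suc z) (s≤s b<z) _ = inW-false (inBd (notIn A)) (suc z)
    (interior∉∂ (notIn A) z (Aᶜ∋ z b<z) (Aᶜ∋ (suc z) (m<n⇒m<1+n b<z))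
                            (Aᶜ∋ (suc (suc z)) (m<n⇒m<1+n (m<n⇒m<1+n b<z))))

top∈∂ : ∀ {A b} → Top A b → inBd (mem A) b ≡ true
top∈∂ {A} {b} (isTop A∋b aboveB) = right∈∂ (mem A) b A∋b (aboveB (suc b) (n<1+n b))

vol+holes : ∀ {A b} → Top A b → vol A + holes A b ≡ tri b
vol+holes {A} {b} top = begin
  vol A + holes A b
    ≡⟨ cong (_+ holes A b) (vol-top top) ⟩
  sumBelow (suc b) (inW (mem A)) + holes A b
    ≡⟨ sum-+ (suc b) (inW (mem A)) (inW (notIn A)) ⟩
  sumBelow (suc b) (λ z → inW (mem A) z + inW (notIn A) z)
    ≡⟨ sum-cong (suc b) (λ z _ → inW-split (mem A) z) ⟩
  sumBelow (suc b) (λ z → z)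
    ≡⟨ sum-id b ⟩
  tri b
    ∎
  where open ≡-Reasoning

holes-pos : ∀ {A b k} → Top A b → vol A ≤ tri k → k < b → 0 < holes A b
holes-pos {A} {b} {k} top volA≤Tk k<b = ≰⇒> λ noHoles → <⇒≱ Tk<Tb (begin
  tri b               ≡⟨ sym (vol+holes top) ⟩
  vol A + holes A b   ≤⟨ +-monoʳ-≤ (vol A) noHoles ⟩
  vol A + 0           ≡⟨ +-identityʳ (vol A) ⟩
  vol A               ≤⟨ volA≤Tk ⟩
  tri k               ∎)
  where
  open ≤-Reasoning
  Tk<Tb : tri k < tri b
  Tk<Tb = <-≤-trans (m<m+n (tri k) (s≤s z≤n)) (tri-mono k<b)

LastHole : FinSet → ℕ → ℕ → Set
LastHole A b d = d < b × mem A d ≡ false × mem A (suc d) ≡ true × holes A b ≤ tri d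

lastHole : ∀ {A b} → Top A b → 0 < holes A b → Σ ℕ (LastHole A b)
lastHole {A} {b} (isTop A∋b _) holes>0 with lastBelow (notIn A) b
... | inj₂ noHole = ⊥-elim (<-irrefl (sym noWeight) holes>0)
  where
  filled : ∀ z → z < suc b → notIn A z ≡ false
  filled z z<b+1 with m<1+n⇒m<n∨m≡n z<b+1
  ... | inj₁ z<b  = noHole z z<b
  ... | inj₂ refl = cong not A∋b
  noWeight : holes A b ≡ 0
  noWeight = sum-trunc z≤n (λ z _ z<b+1 → inW-false (notIn A) z (filled z z<b+1))
... | inj₁ (d , d<b , A∌d , filledAbove) =
  d , d<b , not-flip A∌d , filled (suc d) (n<1+n d) d<b , weight
  where
  filled : ∀ z → d < z → z ≤ b → mem A z ≡ true
  filled z d<z z≤b with m≤n⇒m<n∨m≡n z≤b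
  ... | inj₁ z<b  = not-flip (filledAbove z d<z z<b)
  ... | inj₂ refl = A∋b
  weight : holes A b ≤ tri d
  weight = ≤-trans (≤-reflexive (sum-trunc (s≤s (<⇒≤ d<b)) vanish)) (sumInW≤tri (notIn A) d)
    where
    vanish : ∀ z → suc d ≤ z → z < suc b → inW (notIn A) z ≡ 0
    vanish z d<z z<b+1 = inW-false (notIn A) z (cong not (filled z d<z (≤-pred z<b+1)))

-- If b-1 ∉ A, let b' be the next element of A below its top b (b' = 0 if
-- there is none).  Then b' + b ≤ per A, since b' (if present) and b are
-- boundary points, and A ⊆ [0, b'] ∪ {b}, so vol A ≤ T(b') + b.
isolatedTop : ∀ {A b} → Top A b → mem A (b ∸ 1) ≡ false →
              Σ ℕ λ b′ → b′ + b ≤ per A × vol A ≤ tri b′ + b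
isolatedTop {A} {b} top@(isTop A∋b _) A∌b-1 with lastBelow (mem A) b
... | inj₂ alone = 0 , perBound , ≤-reflexive volIsB
  where
  perBound : b ≤ per A
  perBound = subst (b ≤_) (sym (per-top top)) (bd≤ (mem A) (n<1+n b) (top∈∂ top))
  volIsB : vol A ≡ b
  volIsB = begin
    vol A                                      ≡⟨ vol-top top ⟩
    sumBelow b (inW (mem A)) + inW (mem A) b   ≡⟨ cong₂ _+_ (sum-trunc z≤n vanish) (inW-true (mem A) b A∋b) ⟩
    b                                          ∎
    where
    open ≡-Reasoning
    vanish : ∀ z → 0 ≤ z → z < b → inW (mem A) z ≡ 0
    vanish z _ z<b = inW-false (mem A) z (alone z z<b)
... | inj₁ (b′ , b′<b , A∋b′ , gap) = b′ , perBound , volBound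
  where
  b′+1<b : suc b′ < b
  b′+1<b with m≤n⇒m<n∨m≡n b′<b
  ... | inj₁ lt   = lt
  ... | inj₂ refl = ⊥-elim (conflict A∋b′ A∌b-1)
  perBound : b′ + b ≤ per A
  perBound = subst (b′ + b ≤_) (sym (per-top top))
    (bdPair≤ (mem A) b′<b (n<1+n b)
      (right∈∂ (mem A) b′ A∋b′ (gap (suc b′) (n<1+n b′) b′+1<b)) (top∈∂ top))
  volBound : vol A ≤ tri b′ + b
  volBound = begin
    vol A                                      ≡⟨ vol-top top ⟩
    sumBelow b (inW (mem A)) + inW (mem A) b   ≡⟨ cong₂ _+_ (sum-trunc b′<b vanish) (inW-true (mem A) b A∋b) ⟩
    sumBelow (suc b′) (inW (mem A)) + b        ≤⟨ +-monoˡ-≤ b (sumInW≤tri (mem A) b′) ⟩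
    tri b′ + b                                 ∎
    where
    open ≤-Reasoning
    vanish : ∀ z → suc b′ ≤ z → z < b → inW (mem A) z ≡ 0
    vanish z b′<z z<b = inW-false (mem A) z (gap z b′<z z<b)

complementUpTo : FinSet → ℕ → FinSet
complementUpTo A k = record
  { mem     = λ w → (w ≤ᵇ k) ∧ notIn A w
  ; bound   = k
  ; outside = λ z k<z → cong (_∧ notIn A z) (≤ᵇ-false k<z)
  }

mem-complementUpTo : ∀ A {k w} → w ≤ k → mem (complementUpTo A k) w ≡ notIn A w
mem-complementUpTo A {w = w} w≤k = cong (_∧ notIn A w) (≤ᵇ-true w≤k)

vol-complementUpTo : ∀ {A k} → Top A k → vol (complementUpTo A k) ≡ tri k ∸ vol A
vol-complementUpTo {A} {k} top = begin
  vol (complementUpTo A k)  ≡⟨ sum-cong (suc k) sameWeight ⟩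
  holes A k                 ≡⟨ sym (m+n∸m≡n (vol A) (holes A k)) ⟩
  vol A + holes A k ∸ vol A ≡⟨ cong (_∸ vol A) (vol+holes top) ⟩
  tri k ∸ vol A             ∎
  where
  open ≡-Reasoning
  sameWeight : ∀ z → z < suc k → inW (mem (complementUpTo A k)) z ≡ inW (notIn A) z
  sameWeight z z<k+1 = cong (λ c → if c then z else 0) (mem-complementUpTo A (≤-pred z<k+1))

-- If k+1 is the top of A and k ∈ A, then A and the complement of
-- B = {0..k+1} \ A agree on {0..k+1}, while k+1 and k+2 are interior to Bᶜ;
-- so per A exceeds per(Bᶜ) exactly by the boundary point k+1 of A.
per-complementUpTo : ∀ {A k} → Top A (suc k) → mem A k ≡ true →
                     per A ≡ perC (complementUpTo A (suc k)) + suc k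
per-complementUpTo {A} {k} top@(isTop A∋k+1 _) A∋k = begin
  per A
    ≡⟨ per-top top ⟩
  bdSum (mem A) (suc k) + inW (inBd (mem A)) (suc k)
    ≡⟨ cong₂ _+_ (bdSum-local (suc k) agree) (inW-true (inBd (mem A)) (suc k) (top∈∂ top)) ⟩
  bdSum (notIn B) (suc k) + suc k
    ≡⟨ cong (_+ suc k) (sym upperInterior) ⟩
  perC B + suc k
    ∎
  where
  open ≡-Reasoning
  B : FinSet
  B = complementUpTo A (suc k)
  agree : ∀ w → w ≤ suc k → mem A w ≡ notIn B w
  agree w w≤k+1 = sym (trans (cong not (mem-complementUpTo A w≤k+1)) (not-involutive (mem A w)))
  Bᶜ∋ : ∀ w → k ≤ w → notIn B w ≡ true
  Bᶜ∋ w k≤w with m≤n⇒m<n∨m≡n k≤w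
  ... | inj₂ refl = trans (sym (agree k (n≤1+n k))) A∋k
  ... | inj₁ k<w with m≤n⇒m<n∨m≡n k<w
  ...   | inj₂ refl  = trans (sym (agree (suc k) ≤-refl)) A∋k+1
  ...   | inj₁ k+1<w = cong not (outside B w k+1<w)
  upperInterior : perC B ≡ bdSum (notIn B) (suc k)
  upperInterior = sum-trunc (m≤n⇒m≤1+n (n≤1+n (suc k))) λ where
    (suc z) (s≤s k≤z) _ → inW-false (inBd (notIn B)) (suc z)
      (interior∉∂ (notIn B) z (Bᶜ∋ z k≤z) (Bᶜ∋ (suc z) (m≤n⇒m≤1+n k≤z))
                              (Bᶜ∋ (suc (suc z)) (m≤n⇒m≤1+n (m≤n⇒m≤1+n k≤z))))

-- If k is the top of A, then the complement of A and B = {0..k} \ A agree on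
-- {0..k}; the complement of A additionally has the boundary point k+1.
perC-complementUpTo : ∀ {A k} → Top A k → perC A ≡ suc k + per (complementUpTo A k)
perC-complementUpTo {A} {k} top@(isTop A∋k aboveK) = begin
  perC A
    ≡⟨ perC-top top ⟩
  bdSum (notIn A) k + inW (inBd (notIn A)) k + inW (inBd (notIn A)) (suc k)
    ≡⟨ cong₂ (λ x y → bdSum (notIn A) k + x + y) kNotInAᶜ∂ k+1InAᶜ∂ ⟩
  bdSum (notIn A) k + 0 + suc k
    ≡⟨ +-comm (bdSum (notIn A) k + 0) (suc k) ⟩
  suc k + (bdSum (notIn A) k + 0)
    ≡⟨ cong (λ x → suc k + (x + 0)) (bdSum-local k agree) ⟩
  suc k + (bdSum (mem B) k + 0)
    ≡⟨ cong (λ y → suc k + (bdSum (mem B) k + y)) (sym kNotInB∂) ⟩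
  suc k + per B
    ∎
  where
  open ≡-Reasoning
  B : FinSet
  B = complementUpTo A k
  agree : ∀ w → w ≤ k → notIn A w ≡ mem B w
  agree w w≤k = sym (mem-complementUpTo A w≤k)
  kNotInAᶜ∂ : inW (inBd (notIn A)) k ≡ 0
  kNotInAᶜ∂ = inW-false (inBd (notIn A)) k (∉⇒∉∂ (notIn A) k (cong not A∋k))
  k+1InAᶜ∂ : inW (inBd (notIn A)) (suc k) ≡ suc k
  k+1InAᶜ∂ = inW-true (inBd (notIn A)) (suc k)
    (left∈∂ (notIn A) (suc k) (cong not (aboveK (suc k) (n<1+n k))) (cong not A∋k))
  kNotInB∂ : inW (inBd (mem B)) k ≡ 0
  kNotInB∂ = inW-false (inBd (mem B)) k (∉⇒∉∂ (mem B) k (trans (mem-complementUpTo A ≤-refl) (cong not A∋k)))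

k≤top : ∀ {n k A b} → LeastTri n k → vol A ≡ n → Top A b → k ≤ b
k≤top {A = A} {b} least refl top =
  least≤ least (subst (vol A ≤_) (vol+holes top) (m≤m+n (vol A) (holes A b)))

P-isolated : ∀ {n k A b} → LeastTri n k → vol A ≡ n → Top A b → mem A (b ∸ 1) ≡ false →
             k + k ≤ per A + 2
P-isolated least volA top A∌b-1 with isolatedTop top A∌b-1
... | b′ , b′+b≤per , vol≤ =
  ≤-trans (isolatedBound least (subst (_≤ _) volA vol≤) (k≤top least volA top)) (+-monoˡ-≤ 2 b′+b≤per)

P-full : ∀ {n q A k} → 1 ≤ k → vol A ≡ n → Top A k → mem A (k ∸ 1) ≡ true →
         (∀ B → vol B ≡ tri k ∸ n → q ≤ perC B) → k + q ≤ per A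
P-full {q = q} {A} {suc k} (s≤s z≤n) refl top A∋k minQ = begin
  suc k + q        ≤⟨ +-monoʳ-≤ (suc k) (minQ B (vol-complementUpTo top)) ⟩
  suc k + perC B   ≡⟨ +-comm (suc k) (perC B) ⟩
  perC B + suc k   ≡⟨ sym (per-complementUpTo top A∋k) ⟩
  per A            ∎
  where
  open ≤-Reasoning
  B : FinSet
  B = complementUpTo A (suc k)

-- b > k and b-1 ∈ A:  the boundary points d+1 and b give the square-root bound.
P-gap : ∀ {n k A b} → n ≤ tri k → vol A ≡ n → Top A b → mem A (b ∸ 1) ≡ true → k < b →
        SqrtHalfLe (2 * ((tri k ∸ n) + k + 1)) (2 * k + 3) (per A)
P-gap {A = A} {b} n≤Tk refl top A∋b-1 k<b with lastHole top (holes-pos top n≤Tk k<b)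
... | d , d<b , A∌d , A∋d+1 , holes≤Td = sqrtAlternative n≤Tk k<b (vol+holes top) holes≤Td pair
  where
  d+1<b : suc d < b
  d+1<b with m≤n⇒m<n∨m≡n d<b
  ... | inj₁ lt   = lt
  ... | inj₂ refl = ⊥-elim (conflict A∋b-1 A∌d)
  pair : suc d + b ≤ per A
  pair = subst (suc d + b ≤_) (sym (per-top top))
    (bdPair≤ (mem A) d+1<b (n<1+n b) (left∈∂ (mem A) (suc d) A∋d+1 A∌d) (top∈∂ top))

Q-full : ∀ {n p A k} → vol A ≡ n → Top A k → (∀ B → vol B ≡ tri k ∸ n → p ≤ per B) →
         suc k + p ≤ perC A
Q-full {p = p} {A} {k} refl top minP = begin
  suc k + p       ≤⟨ +-monoʳ-≤ (suc k) (minP B (vol-complementUpTo top)) ⟩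
  suc k + per B   ≡⟨ sym (perC-complementUpTo top) ⟩
  perC A          ∎
  where
  open ≤-Reasoning
  B : FinSet
  B = complementUpTo A k

-- b > k:  the boundary points d and b+1 of Aᶜ give the square-root bound.
Q-gap : ∀ {n k A b} → n ≤ tri k → vol A ≡ n → Top A b → k < b →
        SqrtHalfLe (2 * ((tri k ∸ n) + k + 1)) (2 * k + 3) (perC A)
Q-gap {A = A} {b} n≤Tk refl top@(isTop A∋b aboveB) k<b with lastHole top (holes-pos top n≤Tk k<b)
... | d , d<b , A∌d , A∋d+1 , holes≤Td =
  sqrtAlternative n≤Tk k<b (vol+holes top) holes≤Td (subst (_≤ perC A) (+-suc d b) pair)
  where
  pair : d + suc b ≤ perC A
  pair = subst (d + suc b ≤_) (sym (perC-top top))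
    (bdPair≤ (notIn A) (m<n⇒m<1+n d<b) (n<1+n (suc b))
      (right∈∂ (notIn A) d (cong not A∌d) (cong not A∋d+1))
      (left∈∂ (notIn A) (suc b) (cong not (aboveB (suc b) (n<1+n b))) (cong not A∋b)))

P-bound : ∀ {n k p q} → 1 ≤ n → LeastTri n k → IsP n p → IsQ (tri k ∸ n) q →
          (k + q ≤ p) ⊎ SqrtHalfLe (2 * ((tri k ∸ n) + k + 1)) (2 * k + 3) p ⊎ (k + k ≤ p + 2)
P-bound 1≤n least ((A , volA , refl) , _) (_ , minQ) with top-exists A (subst (1 ≤_) (sym volA) 1≤n)
... | b , top with mem A (b ∸ 1) in b-1∈?
...   | false = inj₂ (inj₂ (P-isolated least volA top b-1∈?))
...   | true with m≤n⇒m<n∨m≡n (k≤top least volA top)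
...     | inj₁ k<b  = inj₂ (inj₁ (P-gap (proj₁ least) volA top b-1∈? k<b))
...     | inj₂ refl = inj₁ (P-full (least-pos 1≤n least) volA top b-1∈? minQ)

Q-bound : ∀ {n k q p} → 1 ≤ n → LeastTri n k → IsQ n q → IsP (tri k ∸ n) p →
          (1 + k + p ≤ q) ⊎ SqrtHalfLe (2 * ((tri k ∸ n) + k + 1)) (2 * k + 3) q
Q-bound 1≤n least ((A , volA , refl) , _) (_ , minP) with top-exists A (subst (1 ≤_) (sym volA) 1≤n)
... | b , top with m≤n⇒m<n∨m≡n (k≤top least volA top)
...   | inj₁ k<b  = inj₂ (Q-gap (proj₁ least) volA top k<b)
...   | inj₂ refl = inj₁ (Q-full volA top minP)

theorem16 : ∀ (n : ℕ) → 2 ≤ n →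
    (∀ (p q : ℕ) → IsP n p → IsQ (g n) q →
      (f n + q ≤ p)
      ⊎ SqrtHalfLe (2 * (g n + f n + 1)) (2 * f n + 3) p
      ⊎ (f n + f n ≤ p + 2))
    × (∀ (q p : ℕ) → IsQ n q → IsP (g n) p →
      (1 + f n + p ≤ q)
      ⊎ SqrtHalfLe (2 * (g n + f n + 1)) (2 * f n + 3) q)
theorem16 n 2≤n = (λ p q → P-bound 1≤n (f-least n)) , (λ q p → Q-bound 1≤n (f-least n))
  where
  1≤n : 1 ≤ n
  1≤n = ≤-trans (s≤s z≤n) 2≤n
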